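{- Let $N = q^k n^2$ be an odd perfect number written in Eulerian form, i.e. $q$ is a prime with $q \equiv k \equiv 1 \pmod 4$, $n$ is a positive integer, and $\gcd(q,n)=1$. Then at least one of the following holds: $n < q^k$, or $$\frac{\sigma(q)}{n} < \frac{\sigma(n)}{q}.$$
   Context: $\sigma(x)$ denotes the sum of the positive divisors of the positive integer $x$. A positive integer $N$ is perfect if $\sigma(N) = 2N$. -}

module Defs where

open import Data.Nat using (ℕ; suc; _+_; _*_)
open import Data.Nat.Divisibility using (_∣?_)
open import Data.List using (List; filter; upTo; map)
open import Data.Nat.ListAction using (sum)

range1 : ℕ → List ℕ
range1 x = map suc (upTo x)

σ : ℕ → ℕ
σ x = sum (filter (_∣? x) (range1 x))

open import Relation.Binary.PropositionalEquality using (_≡_)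

Perfect : ℕ → Set
Perfect N = σ N ≡ 2 * N

{-# OPTIONS --safe #-}
module Submission where

-- If n ≥ q^k then q ≤ n, and q ≠ n because gcd(q, n) = 1, so q < n. Then
-- σ(q) q = (q + 1) q < (q + 1) n ≤ n n ≤ σ(n) n, which is the second
-- alternative after clearing denominators.

open import Defs
open import Data.Nat using (ℕ; _*_; _^_; _<_; _%_; NonZero)
open import Data.Nat.Primality using (Prime)
open import Data.Nat.GCD using (gcd)
open import Data.Nat.Divisibility using (_∤_)
open import Data.Integer using (+_)
open import Data.Rational using (ℚ; _/_)
open import Data.Sum using (_⊎_)
open import Relation.Binary.PropositionalEquality using (_≡_)
import Data.Rational as Q

open import Data.Nat using (zero; suc; _+_; _≤_; z≤n; s≤s; s≤s⁻¹; _<?_; nonTrivial⇒n>1; nonTrivial⇒≢1)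
open import Data.Nat.Properties
open import Data.Nat.Divisibility using (_∣_; _∣?_; ∣-refl; ∣1⇒≡1; 1∣_)
open import Data.Nat.GCD using (gcd-greatest)
open import Data.Nat.Primality using (prime⇒irreducible; prime⇒nonTrivial)
open import Data.List using ([]; _++_; filter; upTo; map; [_])
open import Data.List.Properties using (upTo-∷ʳ; map-++; filter-++; filter-accept; filter-reject)
open import Data.Nat.ListAction using (sum)
open import Data.Nat.ListAction.Properties using (sum-++)
open import Data.Sum using (inj₁; inj₂)
open import Relation.Binary.PropositionalEquality using (refl; sym; cong; subst; subst₂; module ≡-Reasoning)
open import Function using (_∘_)
open import Relation.Nullary using (yes; no; ¬_)
import Data.Rational.Properties as QP
import Data.Rational.Unnormalised as ℚᵘ
import Data.Rational.Unnormalised.Properties as ℚᵘP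
import Data.Integer as ℤ
import Data.Integer.Properties as ℤP

divisorSumUpTo : ℕ → ℕ → ℕ
divisorSumUpTo x m = sum (filter (_∣? x) (range1 m))

divisorSumUpTo-suc : ∀ x m →
  divisorSumUpTo x (suc m) ≡ divisorSumUpTo x m + sum (filter (_∣? x) [ suc m ])
divisorSumUpTo-suc x m = begin
  sum (filter (_∣? x) (map suc (upTo (suc m))))
    ≡⟨ cong (λ l → sum (filter (_∣? x) (map suc l))) (sym (upTo-∷ʳ m)) ⟩
  sum (filter (_∣? x) (map suc (upTo m ++ [ m ])))
    ≡⟨ cong (λ l → sum (filter (_∣? x) l)) (map-++ suc (upTo m) [ m ]) ⟩
  sum (filter (_∣? x) (range1 m ++ [ suc m ]))
    ≡⟨ cong sum (filter-++ (_∣? x) (range1 m) [ suc m ]) ⟩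
  sum (filter (_∣? x) (range1 m) ++ filter (_∣? x) [ suc m ])
    ≡⟨ sum-++ (filter (_∣? x) (range1 m)) (filter (_∣? x) [ suc m ]) ⟩
  divisorSumUpTo x m + sum (filter (_∣? x) [ suc m ]) ∎
  where open ≡-Reasoning

divisorSumUpTo-suc-∣ : ∀ {x m} → suc m ∣ x → divisorSumUpTo x (suc m) ≡ divisorSumUpTo x m + suc m
divisorSumUpTo-suc-∣ {x} {m} d∣x = begin
  divisorSumUpTo x (suc m)                            ≡⟨ divisorSumUpTo-suc x m ⟩
  divisorSumUpTo x m + sum (filter (_∣? x) [ suc m ]) ≡⟨ cong (λ l → divisorSumUpTo x m + sum l) (filter-accept (_∣? x) {xs = []} d∣x) ⟩
  divisorSumUpTo x m + (suc m + 0)                    ≡⟨ cong (λ k → divisorSumUpTo x m + k) (+-identityʳ (suc m)) ⟩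
  divisorSumUpTo x m + suc m                          ∎
  where open ≡-Reasoning

divisorSumUpTo-suc-∤ : ∀ {x m} → ¬ suc m ∣ x → divisorSumUpTo x (suc m) ≡ divisorSumUpTo x m
divisorSumUpTo-suc-∤ {x} {m} d∤x = begin
  divisorSumUpTo x (suc m)                            ≡⟨ divisorSumUpTo-suc x m ⟩
  divisorSumUpTo x m + sum (filter (_∣? x) [ suc m ]) ≡⟨ cong (λ l → divisorSumUpTo x m + sum l) (filter-reject (_∣? x) {xs = []} d∤x) ⟩
  divisorSumUpTo x m + 0                              ≡⟨ +-identityʳ (divisorSumUpTo x m) ⟩
  divisorSumUpTo x m                                  ∎
  where open ≡-Reasoning

n≤σ[n] : ∀ n → n ≤ σ n
n≤σ[n] zero    = z≤n
n≤σ[n] (suc m) rewrite divisorSumUpTo-suc-∣ {suc m} {m} ∣-refl = m≤n+m (suc m) _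

divisorSumUpTo-prime : ∀ {p m} → Prime p → 0 < m → m < p → divisorSumUpTo p m ≡ 1
divisorSumUpTo-prime {p} {suc zero}    _  _ _   = divisorSumUpTo-suc-∣ {p} {0} (1∣ p)
divisorSumUpTo-prime {p} {suc (suc m)} pp _ m<p = begin
  divisorSumUpTo p (suc (suc m)) ≡⟨ divisorSumUpTo-suc-∤ m+2∤p ⟩
  divisorSumUpTo p (suc m)       ≡⟨ divisorSumUpTo-prime pp (s≤s z≤n) (<-trans (n<1+n (suc m)) m<p) ⟩
  1                              ∎
  where
  open ≡-Reasoning
  m+2∤p : ¬ suc (suc m) ∣ p
  m+2∤p d∣p with prime⇒irreducible pp d∣p
  ... | inj₁ ()
  ... | inj₂ refl = <-irrefl refl m<p

σ[p]≡1+p : ∀ {p} → Prime p → σ p ≡ suc p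
σ[p]≡1+p {suc p-1} pp = begin
  divisorSumUpTo (suc p-1) (suc p-1)     ≡⟨ divisorSumUpTo-suc-∣ {suc p-1} {p-1} ∣-refl ⟩
  divisorSumUpTo (suc p-1) p-1 + suc p-1 ≡⟨ cong (_+ suc p-1) (divisorSumUpTo-prime pp 0<p-1 ≤-refl) ⟩
  suc (suc p-1)                          ∎
  where
  open ≡-Reasoning
  0<p-1 : 0 < p-1
  0<p-1 = s≤s⁻¹ (nonTrivial⇒n>1 (suc p-1) {{prime⇒nonTrivial pp}})

gcd≡1∧≡⇒≡1 : ∀ {m n} → gcd m n ≡ 1 → m ≡ n → m ≡ 1
gcd≡1∧≡⇒≡1 {m} gcd≡1 refl = ∣1⇒≡1 (subst (m ∣_) gcd≡1 (gcd-greatest ∣-refl ∣-refl))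

m<n⇒[1+m]*m<n*n : ∀ {m n} → m < n → suc m * m < n * n
m<n⇒[1+m]*m<n*n {m} {n} m<n = begin-strict
  suc m * m <⟨ *-monoʳ-< (suc m) m<n ⟩
  suc m * n ≤⟨ *-monoˡ-≤ n m<n ⟩
  n * n     ∎
  where open ≤-Reasoning

*<*⇒/< : ∀ a b c d .{{_ : NonZero c}} .{{_ : NonZero d}} → a * c < b * d → + a / d Q.< + b / c
-- i / suc d is fromℚᵘ (mkℚᵘ i d) by definition, so the comparison happens in ℚᵘ.
*<*⇒/< a b (suc c-1) (suc d-1) ac<bd = QP.toℚᵘ-cancel-<
  (ℚᵘP.<-respˡ-≃ (ℚᵘP.≃-sym (QP.toℚᵘ-fromℚᵘ (ℚᵘ.mkℚᵘ (+ a) d-1)))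
  (ℚᵘP.<-respʳ-≃ (ℚᵘP.≃-sym (QP.toℚᵘ-fromℚᵘ (ℚᵘ.mkℚᵘ (+ b) c-1)))
    (ℚᵘ.*<* (subst₂ ℤ._<_ (ℤP.pos-* a (suc c-1)) (ℤP.pos-* b (suc d-1)) (ℤ.+<+ ac<bd)))))

mainTheorem2 : (q k n : ℕ) → .{{_ : NonZero q}} → .{{_ : NonZero n}} →
    Prime q → q % 4 ≡ 1 → k % 4 ≡ 1 →
    gcd q n ≡ 1 → 2 ∤ (q ^ k * (n * n)) → Perfect (q ^ k * (n * n)) →
    n < q ^ k ⊎ (+ σ q) / n Q.< (+ σ n) / q
mainTheorem2 q zero n _ _ () _ _ _
mainTheorem2 q k@(suc k-1) n prime-q _ _ gcd≡1 _ _ with n <? q ^ k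
... | yes n<q^k = inj₁ n<q^k
... | no  n≮q^k = inj₂ (*<*⇒/< (σ q) (σ n) q n σ[q]*q<σ[n]*n)
  where
  q≤n : q ≤ n
  q≤n = ≤-trans (m≤m*n q (q ^ k-1) {{m^n≢0 q k-1}}) (≮⇒≥ n≮q^k)
  q<n : q < n
  q<n = ≤∧≢⇒< q≤n (nonTrivial⇒≢1 {{prime⇒nonTrivial prime-q}} ∘ gcd≡1∧≡⇒≡1 gcd≡1)
  σ[q]*q<σ[n]*n : σ q * q < σ n * n
  σ[q]*q<σ[n]*n = begin-strict
    σ q * q   ≡⟨ cong (_* q) (σ[p]≡1+p prime-q) ⟩
    suc q * q <⟨ m<n⇒[1+m]*m<n*n q<n ⟩
    n * n     ≤⟨ *-monoˡ-≤ n (n≤σ[n] n) ⟩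
    σ n * n   ∎
    where open ≤-Reasoning
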